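{- For every simple hypergraph $H$, $|V(H)|-|E(H)|\leq b_L(H)$.
   Context: A hypergraph $H$ consists of a nonempty finite vertex set $V(H)$ and a finite family $E(H)$ of edges, each a subset of $V(H)$. $H$ is simple if no two distinct edges have the same vertex set and every edge contains at least two vertices. Lazy burning: a set $S\subseteq V(H)$ is set on fire; then repeatedly any unburned vertex $v$ lying in an edge $e$ with $|e|\geq 2$ such that all vertices of $e\setminus\{v\}$ are on fire catches fire; $S$ is a lazy burning set if eventually all vertices are on fire; $b_L(H)$ is the minimum size of a lazy burning set. -}

module Defs where

open import Data.Nat using (ℕ; suc; _≤_; _∸_)
open import Data.Fin using (Fin)
open import Data.Fin.Subset using (Subset; _∈_; ∣_∣)
open import Data.Product using (Σ; _×_)
open import Relation.Binary.PropositionalEquality using (_≡_; _≢_)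
open import Function.Definitions using (Injective)

-- A hypergraph with vertex set Fin n (n ≥ 1 enforced by using suc n below)
-- and a finite family of m edges indexed by Fin m (repetitions allowed in general).
record Hypergraph (n m : ℕ) : Set where
  field
    edge : Fin m → Subset n

open Hypergraph public

record Simple {n m : ℕ} (H : Hypergraph n m) : Set where
  field
    distinct : Injective _≡_ _≡_ (edge H)
    size≥2   : ∀ (i : Fin m) → 2 ≤ ∣ edge H i ∣

-- The set of vertices eventually on fire when S is set on fire (lazy burning),
-- as the least set containing S and closed under the propagation rule.
data OnFire {n m : ℕ} (H : Hypergraph n m) (S : Subset n) : Fin n → Set where
  initial   : ∀ {v} → v ∈ S → OnFire H S v
  propagate : ∀ {v} (i : Fin m) → v ∈ edge H i → 2 ≤ ∣ edge H i ∣ →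
              (∀ u → u ∈ edge H i → u ≢ v → OnFire H S u) →
              OnFire H S v

IsLazyBurningSet : ∀ {n m} → Hypergraph n m → Subset n → Set
IsLazyBurningSet H S = ∀ v → OnFire H S v

IsLazyBurningNumber : ∀ {n m} → Hypergraph n m → ℕ → Set
IsLazyBurningNumber {n} H b =
  Σ (Subset n) (λ S → IsLazyBurningSet H S × ∣ S ∣ ≡ b)
  × (∀ S → IsLazyBurningSet H S → b ≤ ∣ S ∣)

-- Burn the vertices outside S one at a time, each by an edge all of whose
-- other vertices are already on fire. Such an edge is contained in the burnt
-- set right after the step but not before it, so each step completes a new
-- edge: the number of burnt vertices never exceeds |S| plus the number of
-- edges lying inside the burnt set. Once every vertex burns, |V| ≤ |S| + |E|.
module Submission where

open import Defs
open import Data.Nat using (ℕ; zero; suc; _+_; _≤_; _∸_; z≤n; s≤s)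
open import Data.Nat.Properties
open import Data.Fin using (Fin)
open import Data.Fin.Properties using (any?)
open import Data.Fin.Subset
  using (Subset; inside; outside; _∈_; _∉_; _⊆_; _⊈_; _⊂_; _∪_; ⁅_⁆; ⊤; ∣_∣)
open import Data.Fin.Subset.Properties
  using (_∈?_; _⊆?_; ⊆-refl; ⊆-trans; ∣⊤∣≡n; ∣p∣≤n; p⊆q⇒∣p∣≤∣q∣; p⊂q⇒∣p∣<∣q∣;
         p⊆p∪q; x∈p∪q⁺; x∈⁅x⁆; ∣⁅x⁆∣≡1; x∉⁅y⁆⇒x≢y)
open import Data.Vec using ([]; _∷_; tabulate)
open import Data.Vec.Properties using (lookup∘tabulate; []=⇒lookup; lookup⇒[]=)
open import Data.Product using (∃; _×_; _,_)
open import Data.Empty using (⊥-elim)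
open import Data.Sum using (inj₁; inj₂)
open import Function using (_∘_)
open import Relation.Nullary using (does; yes; no; contradiction)
open import Relation.Nullary.Decidable using (dec-true; decidable-stable; ¬?; _×-dec_)
open import Relation.Unary using (Pred; Decidable)
open import Relation.Binary.PropositionalEquality using (sym; trans; cong; subst)

select : ∀ {n p} {P : Pred (Fin n) p} → Decidable P → Subset n
select P? = tabulate (does ∘ P?)

module _ {n p} {P : Pred (Fin n) p} (P? : Decidable P) where

  ∈-select⁺ : ∀ {i} → P i → i ∈ select P?
  ∈-select⁺ {i} Pi =
    lookup⇒[]= i (select P?) (trans (lookup∘tabulate (does ∘ P?) i) (dec-true (P? i) Pi))

  ∈-select⁻ : ∀ {i} → i ∈ select P? → P i
  ∈-select⁻ {i} i∈ with P? i | lookup∘tabulate (does ∘ P?) i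
  ... | yes Pi | _  = Pi
  ... | no _   | eq = contradiction (trans (sym ([]=⇒lookup i∈)) eq) λ ()

⊈⇒∃∉ : ∀ {n} {p q : Subset n} → p ⊈ q → ∃ λ x → x ∈ p × x ∉ q
⊈⇒∃∉ {p = p} {q} p⊈q with any? (λ x → x ∈? p ×-dec ¬? (x ∈? q))
... | yes witness = witness
... | no none     = ⊥-elim (p⊈q p⊆q)
  where
  p⊆q : p ⊆ q
  p⊆q {x} x∈p = decidable-stable (x ∈? q) (λ x∉q → none (x , x∈p , x∉q))

∣p∪q∣≤∣p∣+∣q∣ : ∀ {n} (p q : Subset n) → ∣ p ∪ q ∣ ≤ ∣ p ∣ + ∣ q ∣
∣p∪q∣≤∣p∣+∣q∣ []            []            = z≤n
∣p∪q∣≤∣p∣+∣q∣ (outside ∷ p) (outside ∷ q) = ∣p∪q∣≤∣p∣+∣q∣ p q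
∣p∪q∣≤∣p∣+∣q∣ (outside ∷ p) (inside ∷ q)  =
  ≤-trans (s≤s (∣p∪q∣≤∣p∣+∣q∣ p q)) (≤-reflexive (sym (+-suc ∣ p ∣ ∣ q ∣)))
∣p∪q∣≤∣p∣+∣q∣ (inside ∷ p)  (outside ∷ q) = s≤s (∣p∪q∣≤∣p∣+∣q∣ p q)
∣p∪q∣≤∣p∣+∣q∣ (inside ∷ p)  (inside ∷ q)  =
  s≤s (≤-trans (∣p∪q∣≤∣p∣+∣q∣ p q) (+-monoʳ-≤ ∣ p ∣ (n≤1+n ∣ q ∣)))

module _ {n m : ℕ} (H : Hypergraph n m) where

  completedEdges : Subset n → Subset m
  completedEdges T = select (λ i → edge H i ⊆? T)

  ∈-completedEdges⁺ : ∀ {T i} → edge H i ⊆ T → i ∈ completedEdges T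
  ∈-completedEdges⁺ {T} = ∈-select⁺ (λ i → edge H i ⊆? T)

  ∈-completedEdges⁻ : ∀ {T i} → i ∈ completedEdges T → edge H i ⊆ T
  ∈-completedEdges⁻ {T} = ∈-select⁻ (λ i → edge H i ⊆? T)

  completedEdges-mono : ∀ {T T′} → T ⊆ T′ → completedEdges T ⊆ completedEdges T′
  completedEdges-mono T⊆T′ i∈ = ∈-completedEdges⁺ (λ x∈ → T⊆T′ (∈-completedEdges⁻ i∈ x∈))

  record Ignition (T : Subset n) : Set where
    constructor ignition
    field
      vertex         : Fin n
      unburnt        : vertex ∉ T
      igniter        : Fin m
      vertex∈igniter : vertex ∈ edge H igniter
      igniter⊆       : edge H igniter ⊆ T ∪ ⁅ vertex ⁆

    burnt : Subset n
    burnt = T ∪ ⁅ vertex ⁆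

    T⊂burnt : T ⊂ burnt
    T⊂burnt = p⊆p∪q _ , vertex , x∈p∪q⁺ (inj₂ (x∈⁅x⁆ vertex)) , unburnt

    ∣burnt∣≤1+∣T∣ : ∣ burnt ∣ ≤ suc ∣ T ∣
    ∣burnt∣≤1+∣T∣ = begin
      ∣ burnt ∣            ≤⟨ ∣p∪q∣≤∣p∣+∣q∣ T ⁅ vertex ⁆ ⟩
      ∣ T ∣ + ∣ ⁅ vertex ⁆ ∣ ≡⟨ cong (∣ T ∣ +_) (∣⁅x⁆∣≡1 vertex) ⟩
      ∣ T ∣ + 1            ≡⟨ +-comm ∣ T ∣ 1 ⟩
      suc ∣ T ∣            ∎
      where open ≤-Reasoning

    completedEdges⊂ : completedEdges T ⊂ completedEdges burnt
    completedEdges⊂ =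
      completedEdges-mono (p⊆p∪q _) , igniter , ∈-completedEdges⁺ igniter⊆ ,
      λ i∈ → unburnt (∈-completedEdges⁻ i∈ vertex∈igniter)

  open Ignition

  -- If the edge that set u on fire is not yet ready to fire at T, one of its
  -- other vertices is unburnt at T and caught fire before u.
  findIgnition : ∀ {S T u} → S ⊆ T → OnFire H S u → u ∉ T → Ignition T
  findIgnition S⊆T (initial u∈S) u∉T = contradiction (S⊆T u∈S) u∉T
  findIgnition {T = T} {u} S⊆T (propagate i u∈e _ othersOnFire) u∉T with edge H i ⊆? T ∪ ⁅ u ⁆
  ... | yes e⊆ = ignition u u∉T i u∈e e⊆
  ... | no e⊈ with ⊈⇒∃∉ e⊈
  ...   | x , x∈e , x∉ =
    findIgnition S⊆T (othersOnFire x x∈e (x∉⁅y⁆⇒x≢y (x∉ ∘ x∈p∪q⁺ ∘ inj₂))) (x∉ ∘ x∈p∪q⁺ ∘ inj₁)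

  module _ {S : Subset n} (burning : IsLazyBurningSet H S) where

    Accounted : Subset n → Set
    Accounted T = ∣ T ∣ ≤ ∣ S ∣ + ∣ completedEdges T ∣

    accounted-burnt : ∀ {T} (ig : Ignition T) → Accounted T → Accounted (burnt ig)
    accounted-burnt {T} ig acc = begin
      ∣ burnt ig ∣                          ≤⟨ ∣burnt∣≤1+∣T∣ ig ⟩
      suc ∣ T ∣                             ≤⟨ s≤s acc ⟩
      suc (∣ S ∣ + ∣ completedEdges T ∣)    ≡⟨ sym (+-suc ∣ S ∣ _) ⟩
      ∣ S ∣ + suc ∣ completedEdges T ∣      ≤⟨ +-monoʳ-≤ ∣ S ∣ (p⊂q⇒∣p∣<∣q∣ (completedEdges⊂ ig)) ⟩
      ∣ S ∣ + ∣ completedEdges (burnt ig) ∣ ∎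
      where open ≤-Reasoning

    accounted-full : ∀ {T} → n ≤ ∣ T ∣ → Accounted T → n ≤ ∣ S ∣ + m
    accounted-full {T} n≤∣T∣ acc =
      ≤-trans n≤∣T∣ (≤-trans acc (+-monoʳ-≤ ∣ S ∣ (∣p∣≤n (completedEdges T))))

    burnAll : ∀ k T → S ⊆ T → n ≤ k + ∣ T ∣ → Accounted T → n ≤ ∣ S ∣ + m
    burnAll zero T _ n≤∣T∣ acc = accounted-full n≤∣T∣ acc
    burnAll (suc k) T S⊆T n≤ acc with any? (λ u → ¬? (u ∈? T))
    ... | no noneUnburnt = accounted-full n≤∣T∣ acc
      where
      ⊤⊆T : ⊤ ⊆ T
      ⊤⊆T {u} _ = decidable-stable (u ∈? T) (λ u∉T → noneUnburnt (u , u∉T))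
      n≤∣T∣ : n ≤ ∣ T ∣
      n≤∣T∣ = ≤-trans (≤-reflexive (sym (∣⊤∣≡n n))) (p⊆q⇒∣p∣≤∣q∣ ⊤⊆T)
    ... | yes (u , u∉T) =
      burnAll k (burnt ig) (⊆-trans S⊆T (p⊆p∪q _)) n≤′ (accounted-burnt ig acc)
      where
      ig : Ignition T
      ig = findIgnition S⊆T (burning u) u∉T
      n≤′ : n ≤ k + ∣ burnt ig ∣
      n≤′ = ≤-trans n≤ (≤-trans (≤-reflexive (sym (+-suc k ∣ T ∣)))
                                 (+-monoʳ-≤ k (p⊂q⇒∣p∣<∣q∣ (T⊂burnt ig))))

    lazyBurningSet-bound : n ∸ m ≤ ∣ S ∣
    lazyBurningSet-bound = m≤n+o⇒m∸n≤o n m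
      (≤-trans (burnAll n S ⊆-refl (m≤m+n n ∣ S ∣) (m≤m+n ∣ S ∣ _))
               (≤-reflexive (+-comm ∣ S ∣ m)))

mainTheorem9 : ∀ (n m : ℕ) (H : Hypergraph (suc n) m) → Simple H →
    ∀ (b : ℕ) → IsLazyBurningNumber H b → suc n ∸ m ≤ b
mainTheorem9 n m H _ b ((S , burning , ∣S∣≡b) , _) =
  subst (suc n ∸ m ≤_) ∣S∣≡b (lazyBurningSet-bound H burning)
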